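{- Let $n,k$ be integers with $1\le k\le n$. The following are equivalent: (a) $S(n,k)$ is odd. (b) $\#([n]\cap[n-k]) = \sigma(n)-\sigma(k)$ and $\nu(S(n,k)) = \sigma(k)-\sigma(n)+\#([n]\cap[n-k])$ (i.e., $S(n,k)$ is a MZC or an AMZC). (c) $\#([n-1]\cap[n-k]) = \sigma(n-1)-\sigma(k-1)$ and $\nu(S(n,k)) = \sigma(k-1)-\sigma(n-1)+\#([n-1]\cap[n-k])$ (i.e., $S(n,k)$ is a SMZC or a SAMZC).
   Context: $S(n,k)$ denotes the Stirling number of the second kind and $\nu$ the $2$-adic valuation. For a nonnegative integer $m$, $\sigma(m)$ is the sum of the base-$2$ digits of $m$ and $[m]$ is the set of powers of $2$ in the base-$2$ expansion of $m$. Terminology: $S(n,k)$ is a MZC (minimum zero case) if $\nu(S(n,k))=\sigma(k)-\sigma(n)$; an AMZC (almost minimum zero case) if it is not a MZC and $\nu(S(n,k))=\sigma(k)-\sigma(n)+\#([n]\cap[n-k])$; a SMZC (shifted minimum zero case) if $\nu(S(n,k))=\sigma(k-1)-\sigma(n-1)$; a SAMZC (shifted almost minimum zero case) if it is not a SMZC and $\nu(S(n,k))=\sigma(k-1)-\sigma(n-1)+\#([n-1]\cap[n-k])$. It is known that $\nu(S(n,k))\ge \sigma(k)-\sigma(n)+\#([n]\cap[n-k])$ and $\nu(S(n,k))\ge\sigma(k-1)-\sigma(n-1)+\#([n-1]\cap[n-k])$. -}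

module Defs where

open import Data.Nat using (ℕ; zero; suc; _+_; _*_; _^_; _/_; _%_)
open import Data.Nat.DivMod using ()
open import Data.List using (List; map; upTo)
open import Data.Nat.ListAction using (sum)
open import Data.Bool using (if_then_else_)
open import Relation.Nullary.Decidable using (does)
open import Data.Nat using (_≟_)

S : ℕ → ℕ → ℕ
S zero    zero    = 1
S zero    (suc k) = 0
S (suc n) zero    = 0
S (suc n) (suc k) = suc k * S n (suc k) + S n k

bit : ℕ → ℕ → ℕ
bit zero    m = m % 2
bit (suc i) m = bit i (m / 2)

-- σ(m): sum of the base-2 digits of m  (digits at positions ≥ m+1 are 0)
σ : ℕ → ℕ
σ m = sum (map (λ i → bit i m) (upTo (suc m)))

-- #([a] ∩ [b]): number of powers of 2 occurring in the base-2 expansions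
-- of both a and b (positions ≥ a+1 are 0 in a)
#∩ : ℕ → ℕ → ℕ
#∩ a b = sum (map (λ i → bit i a * bit i b) (upTo (suc a)))

-- 2-adic valuation; fuel-bounded helper.  Convention ν(0) = 0
-- (only ever applied to positive numbers in the statement).
ν-aux : ℕ → ℕ → ℕ
ν-aux zero     m = 0
ν-aux (suc f)  zero = 0
ν-aux (suc f)  (suc m) =
  if does (suc m % 2 ≟ 0) then suc (ν-aux f (suc m / 2)) else 0

ν : ℕ → ℕ
ν m = ν-aux m m

-- If S(n,k) is odd then ν(S(n,k)) = 0, and conditions (b) and (c) collapse to the digit identities
--   σ(n) = σ(k) + #([n] ∩ [n-k])   and   σ(n-1) = σ(k-1) + #([n-1] ∩ [n-k]);
-- conversely either condition forces ν(S(n,k)) = 0, i.e. S(n,k) odd, as S(n,k) > 0.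
-- So everything rests on: S(n,k) odd implies both identities.  Writing k = 2w+1 or k = 2w+2
-- and m = n - k, the Stirling recurrence gives S(n,k) ≡ C(w+m, w) (mod 2), and the identities
-- σ(j+m) = σ(j) + #([j+m] ∩ [m]) for j = 2w, 2w+1, 2w+2 follow from C(w+m, w) odd by induction
-- on the binary digits of m, using Lucas' theorem for binomial coefficients mod 2.
module Submission where

open import Defs
open import Data.Nat
  using (ℕ; zero; suc; _+_; _*_; _∸_; _≤_; _<_; z≤n; s≤s; _/_; _%_; parity)
open import Data.Nat.Properties
  using (≤-trans; ≤-pred; n≮0; n≤1+n; n<1+n; m<n⇒m<1+n; m≤n+m;
         +-suc; +-identityʳ; *-identityˡ; *-zeroʳ; m+n∸m≡n; m≤n⇒∃[o]m+o≡n)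
open import Data.Nat.DivMod using (m/n≤m; m/n<m; m/n≡1+[m∸n]/n; m%n<n)
open import Data.Nat.Divisibility
  using (_∣_; _∣0; ∣-refl; ∣m∣n⇒∣m+n; m%n≡0⇒n∣m; n∣m⇒m%n≡0)
open import Data.Nat.Induction using (<-rec)
open import Data.Nat.ListAction using (sum)
open import Data.List using (applyUpTo)
open import Data.List.Properties using (map-upTo)
open import Data.Parity.Base using (Parity; 0ℙ; 1ℙ) renaming (_+_ to _⊕_; _*_ to _⊗_)
open import Data.Parity.Properties
  using (p+p≡0ℙ; +-homo-+; *-homo-*) renaming (+-identityʳ to ⊕-identityʳ; +-comm to ⊕-comm)
open import Data.Integer using (ℤ; +_; _-_) renaming (_+_ to _+ℤ_)
open import Data.Integer.Properties using (+-injective)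
open import Data.Integer.Tactic.RingSolver using (solve-∀)
open import Data.Product using (_×_; _,_; proj₁; proj₂)
open import Data.Empty using (⊥-elim)
open import Function using (_∘_)
open import Function.Bundles using (_⇔_; mk⇔)
open import Relation.Nullary using (¬_)
open import Relation.Binary.PropositionalEquality

digitSum : (ℕ → ℕ → ℕ) → ℕ → ℕ → ℕ → ℕ
digitSum g zero    a b = 0
digitSum g (suc f) a b = g (a % 2) (b % 2) + digitSum g f (a / 2) (b / 2)

sum-bits≡digitSum : ∀ g f a b → sum (applyUpTo (λ i → g (bit i a) (bit i b)) f) ≡ digitSum g f a b
sum-bits≡digitSum g zero    a b = refl
sum-bits≡digitSum g (suc f) a b =
  cong (_+_ (g (a % 2) (b % 2))) (sum-bits≡digitSum g f (a / 2) (b / 2))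

digitSum-zeroʳ : ∀ {g} → (∀ x → g x 0 ≡ 0) → ∀ f a → digitSum g f a 0 ≡ 0
digitSum-zeroʳ g0 zero    a = refl
digitSum-zeroʳ g0 (suc f) a = cong₂ _+_ (g0 (a % 2)) (digitSum-zeroʳ g0 f (a / 2))

module _ {g : ℕ → ℕ → ℕ} (g0 : ∀ y → g 0 y ≡ 0) where

  digitSum-zeroˡ : ∀ f b → digitSum g f 0 b ≡ 0
  digitSum-zeroˡ zero    b = refl
  digitSum-zeroˡ (suc f) b = cong₂ _+_ (g0 (b % 2)) (digitSum-zeroˡ f (b / 2))

  -- a has at most a binary digits, so any fuel f ≥ a reads all of them.
  digitSum-fuel : ∀ {f f′} a b → a ≤ f → a ≤ f′ → digitSum g f a b ≡ digitSum g f′ a b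
  digitSum-fuel {f} {f′} zero b _ _ = trans (digitSum-zeroˡ f b) (sym (digitSum-zeroˡ f′ b))
  digitSum-fuel (suc a) b (s≤s a≤f) (s≤s a≤f′) =
    cong (_+_ (g (suc a % 2) (b % 2)))
      (digitSum-fuel (suc a / 2) (b / 2) (≤-trans half≤a a≤f) (≤-trans half≤a a≤f′))
    where
    half≤a : suc a / 2 ≤ a
    half≤a = ≤-pred (m/n<m (suc a) 2 (s≤s (s≤s z≤n)))

  digitSum-halve : ∀ a b →
    digitSum g (suc a) a b ≡ g (a % 2) (b % 2) + digitSum g (suc (a / 2)) (a / 2) (b / 2)
  digitSum-halve a b =
    cong (_+_ (g (a % 2) (b % 2))) (digitSum-fuel (a / 2) (b / 2) (m/n≤m a 2) (n≤1+n (a / 2)))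

σ≡digitSum : ∀ m → σ m ≡ digitSum (λ x _ → x) (suc m) m 0
σ≡digitSum m =
  trans (cong sum (map-upTo (λ i → bit i m) (suc m))) (sum-bits≡digitSum _ (suc m) m 0)

#∩≡digitSum : ∀ a b → #∩ a b ≡ digitSum _*_ (suc a) a b
#∩≡digitSum a b =
  trans (cong sum (map-upTo (λ i → bit i a * bit i b) (suc a))) (sum-bits≡digitSum _*_ (suc a) a b)

σ-halve : ∀ m → σ m ≡ m % 2 + σ (m / 2)
σ-halve m = begin
  σ m                                                    ≡⟨ σ≡digitSum m ⟩
  digitSum (λ x _ → x) (suc m) m 0                        ≡⟨ digitSum-halve (λ _ → refl) m 0 ⟩
  m % 2 + digitSum (λ x _ → x) (suc (m / 2)) (m / 2) 0   ≡⟨ cong (_+_ (m % 2)) (σ≡digitSum (m / 2)) ⟨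
  m % 2 + σ (m / 2)                                      ∎
  where open ≡-Reasoning

#∩-halve : ∀ a b → #∩ a b ≡ a % 2 * (b % 2) + #∩ (a / 2) (b / 2)
#∩-halve a b = begin
  #∩ a b                                                 ≡⟨ #∩≡digitSum a b ⟩
  digitSum _*_ (suc a) a b                               ≡⟨ digitSum-halve (λ _ → refl) a b ⟩
  a % 2 * (b % 2) + digitSum _*_ (suc (a / 2)) (a / 2) (b / 2)
    ≡⟨ cong (_+_ (a % 2 * (b % 2))) (#∩≡digitSum (a / 2) (b / 2)) ⟨
  a % 2 * (b % 2) + #∩ (a / 2) (b / 2)                   ∎
  where open ≡-Reasoning

#∩-zeroʳ : ∀ a → #∩ a 0 ≡ 0
#∩-zeroʳ a = trans (#∩≡digitSum a 0) (digitSum-zeroʳ *-zeroʳ (suc a) a)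

double : ℕ → ℕ
double zero    = 0
double (suc x) = suc (suc (double x))

data Halves : ℕ → Set where
  even : ∀ x → Halves (double x)
  odd  : ∀ x → Halves (suc (double x))

halves : ∀ n → Halves n
halves zero = even zero
halves (suc n) with halves n
... | even x = odd x
... | odd x  = even (suc x)

double-+ : ∀ x y → double (x + y) ≡ double x + double y
double-+ zero    y = refl
double-+ (suc x) y = cong (suc ∘ suc) (double-+ x y)

x≤double : ∀ x → x ≤ double x
x≤double zero    = z≤n
x≤double (suc x) = s≤s (≤-trans (x≤double x) (n≤1+n _))

double%2 : ∀ x → double x % 2 ≡ 0
double%2 zero    = refl
double%2 (suc x) = double%2 x

suc-double%2 : ∀ x → suc (double x) % 2 ≡ 1
suc-double%2 zero    = refl
suc-double%2 (suc x) = suc-double%2 x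

[2+n]/2≡1+n/2 : ∀ n → suc (suc n) / 2 ≡ suc (n / 2)
[2+n]/2≡1+n/2 n = m/n≡1+[m∸n]/n {suc (suc n)} {2} (s≤s (s≤s z≤n))

double/2 : ∀ x → double x / 2 ≡ x
double/2 zero    = refl
double/2 (suc x) = trans ([2+n]/2≡1+n/2 (double x)) (cong suc (double/2 x))

suc-double/2 : ∀ x → suc (double x) / 2 ≡ x
suc-double/2 zero    = refl
suc-double/2 (suc x) = trans ([2+n]/2≡1+n/2 (suc (double x))) (cong suc (suc-double/2 x))

parity-double : ∀ x → parity (double x) ≡ 0ℙ
parity-double zero    = refl
parity-double (suc x) = parity-double x

parity-suc-double : ∀ x → parity (suc (double x)) ≡ 1ℙ
parity-suc-double zero    = refl
parity-suc-double (suc x) = parity-suc-double x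

σ-double : ∀ x → σ (double x) ≡ σ x
σ-double x = trans (σ-halve (double x)) (cong₂ _+_ (double%2 x) (cong σ (double/2 x)))

σ-suc-double : ∀ x → σ (suc (double x)) ≡ suc (σ x)
σ-suc-double x =
  trans (σ-halve (suc (double x))) (cong₂ _+_ (suc-double%2 x) (cong σ (suc-double/2 x)))

#∩-double-double : ∀ a b → #∩ (double a) (double b) ≡ #∩ a b
#∩-double-double a b = trans (#∩-halve (double a) (double b))
  (cong₂ _+_ (cong₂ _*_ (double%2 a) (double%2 b)) (cong₂ #∩ (double/2 a) (double/2 b)))

#∩-double-odd : ∀ a b → #∩ (double a) (suc (double b)) ≡ #∩ a b
#∩-double-odd a b = trans (#∩-halve (double a) (suc (double b)))
  (cong₂ _+_ (cong₂ _*_ (double%2 a) (suc-double%2 b)) (cong₂ #∩ (double/2 a) (suc-double/2 b)))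

#∩-odd-double : ∀ a b → #∩ (suc (double a)) (double b) ≡ #∩ a b
#∩-odd-double a b = trans (#∩-halve (suc (double a)) (double b))
  (cong₂ _+_ (cong₂ _*_ (suc-double%2 a) (double%2 b)) (cong₂ #∩ (suc-double/2 a) (double/2 b)))

#∩-odd-odd : ∀ a b → #∩ (suc (double a)) (suc (double b)) ≡ suc (#∩ a b)
#∩-odd-odd a b = trans (#∩-halve (suc (double a)) (suc (double b)))
  (cong₂ _+_ (cong₂ _*_ (suc-double%2 a) (suc-double%2 b))
             (cong₂ #∩ (suc-double/2 a) (suc-double/2 b)))

-- With k = j + 1 and n = j + m + 1, condition (b) of the theorem at ν = 0 is Balanced k m,
-- and condition (c) is Balanced j m.
Balanced : ℕ → ℕ → Set
Balanced j m = #∩ (j + m) m + σ j ≡ σ (j + m)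

balanced-zero : ∀ j → Balanced j 0
balanced-zero j = begin
  #∩ (j + 0) 0 + σ j  ≡⟨ cong (_+ σ j) (#∩-zeroʳ (j + 0)) ⟩
  σ j                 ≡⟨ cong σ (+-identityʳ j) ⟨
  σ (j + 0)           ∎
  where open ≡-Reasoning

balanced-double-double : ∀ x m → Balanced x m → Balanced (double x) (double m)
balanced-double-double x m b = begin
  #∩ (double x + double m) (double m) + σ (double x)
    ≡⟨ cong₂ _+_ (cong (λ t → #∩ t (double m)) (sym (double-+ x m))) (σ-double x) ⟩
  #∩ (double (x + m)) (double m) + σ x   ≡⟨ cong (_+ σ x) (#∩-double-double (x + m) m) ⟩
  #∩ (x + m) m + σ x                     ≡⟨ b ⟩
  σ (x + m)                              ≡⟨ σ-double (x + m) ⟨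
  σ (double (x + m))                     ≡⟨ cong σ (double-+ x m) ⟩
  σ (double x + double m)                ∎
  where open ≡-Reasoning

balanced-odd-double : ∀ x m → Balanced x m → Balanced (suc (double x)) (double m)
balanced-odd-double x m b = begin
  #∩ (suc (double x + double m)) (double m) + σ (suc (double x))
    ≡⟨ cong₂ _+_ (cong (λ t → #∩ (suc t) (double m)) (sym (double-+ x m))) (σ-suc-double x) ⟩
  #∩ (suc (double (x + m))) (double m) + suc (σ x)
    ≡⟨ cong (_+ suc (σ x)) (#∩-odd-double (x + m) m) ⟩
  #∩ (x + m) m + suc (σ x)               ≡⟨ +-suc _ (σ x) ⟩
  suc (#∩ (x + m) m + σ x)               ≡⟨ cong suc b ⟩
  suc (σ (x + m))                        ≡⟨ σ-suc-double (x + m) ⟨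
  σ (suc (double (x + m)))               ≡⟨ cong (σ ∘ suc) (double-+ x m) ⟩
  σ (suc (double x + double m))          ∎
  where open ≡-Reasoning

balanced-double-odd : ∀ x m → Balanced x m → Balanced (double x) (suc (double m))
balanced-double-odd x m b = begin
  #∩ (double x + suc (double m)) (suc (double m)) + σ (double x)
    ≡⟨ cong₂ _+_ (cong (λ t → #∩ t (suc (double m))) double-suc) (σ-double x) ⟩
  #∩ (suc (double (x + m))) (suc (double m)) + σ x
    ≡⟨ cong (_+ σ x) (#∩-odd-odd (x + m) m) ⟩
  suc (#∩ (x + m) m + σ x)               ≡⟨ cong suc b ⟩
  suc (σ (x + m))                        ≡⟨ σ-suc-double (x + m) ⟨
  σ (suc (double (x + m)))               ≡⟨ cong σ double-suc ⟨
  σ (double x + suc (double m))          ∎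
  where
  open ≡-Reasoning
  double-suc : double x + suc (double m) ≡ suc (double (x + m))
  double-suc = trans (+-suc (double x) (double m)) (cong suc (sym (double-+ x m)))

-- The units digits carry; the hypothesis on σ says that adding this carry to x creates no further one.
balanced-odd-odd : ∀ x m → σ (suc x) ≡ suc (σ x) → Balanced (suc x) m →
                   Balanced (suc (double x)) (suc (double m))
balanced-odd-odd x m σ-no-carry b = begin
  #∩ (suc (double x) + suc (double m)) (suc (double m)) + σ (suc (double x))
    ≡⟨ cong₂ _+_ (cong (λ t → #∩ t (suc (double m))) odd-sum) (σ-suc-double x) ⟩
  #∩ (double (suc x + m)) (suc (double m)) + suc (σ x)
    ≡⟨ cong₂ _+_ (#∩-double-odd (suc x + m) m) (sym σ-no-carry) ⟩
  #∩ (suc x + m) m + σ (suc x)           ≡⟨ b ⟩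
  σ (suc x + m)                          ≡⟨ σ-double (suc x + m) ⟨
  σ (double (suc x + m))                 ≡⟨ cong σ odd-sum ⟨
  σ (suc (double x) + suc (double m))    ∎
  where
  open ≡-Reasoning
  odd-sum : suc (double x) + suc (double m) ≡ double (suc x + m)
  odd-sum = cong suc (trans (+-suc (double x) (double m)) (cong suc (sym (double-+ x m))))

-- binom₂ a b is the parity of the binomial coefficient C(a + b, a), computed by Pascal's rule.
binom₂ : ℕ → ℕ → Parity
binom₂ zero    b       = 1ℙ
binom₂ (suc a) zero    = 1ℙ
binom₂ (suc a) (suc b) = binom₂ a (suc b) ⊕ binom₂ (suc a) b

binom₂-zeroʳ : ∀ a → binom₂ a zero ≡ 1ℙ
binom₂-zeroʳ zero    = refl
binom₂-zeroʳ (suc a) = refl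

mutual
  binom₂-double-double : ∀ x y → binom₂ (double x) (double y) ≡ binom₂ x y
  binom₂-double-double zero    y       = refl
  binom₂-double-double (suc x) zero    = refl
  binom₂-double-double (suc x) (suc y) =
    cong₂ _⊕_ (binom₂-odd-double x (suc y)) (binom₂-double-odd (suc x) y)

  binom₂-odd-double : ∀ x y → binom₂ (suc (double x)) (double y) ≡ binom₂ x y
  binom₂-odd-double x zero    = sym (binom₂-zeroʳ x)
  binom₂-odd-double x (suc y) =
    trans (cong₂ _⊕_ (binom₂-double-double x (suc y)) (binom₂-odd-odd x y))
          (⊕-identityʳ (binom₂ x (suc y)))

  binom₂-double-odd : ∀ x y → binom₂ (double x) (suc (double y)) ≡ binom₂ x y
  binom₂-double-odd zero    y = refl
  binom₂-double-odd (suc x) y = cong₂ _⊕_ (binom₂-odd-odd x y) (binom₂-double-double (suc x) y)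

  binom₂-odd-odd : ∀ x y → binom₂ (suc (double x)) (suc (double y)) ≡ 0ℙ
  binom₂-odd-odd x y =
    trans (cong₂ _⊕_ (binom₂-double-odd x y) (binom₂-odd-double x y)) (p+p≡0ℙ (binom₂ x y))

BalancedAround : ℕ → ℕ → Set
BalancedAround w m =
  Balanced (double w) m × Balanced (suc (double w)) m × Balanced (suc (suc (double w))) m

binom₂-odd⇒balanced : ∀ m w → binom₂ w m ≡ 1ℙ → BalancedAround w m
binom₂-odd⇒balanced = <-rec _ step
  where
  step : ∀ m → (∀ {m′} → m′ < m → ∀ w → binom₂ w m′ ≡ 1ℙ → BalancedAround w m′) →
         ∀ w → binom₂ w m ≡ 1ℙ → BalancedAround w m
  step m rec w odd-binom with halves m | halves w
  ... | even zero     | _ =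
    balanced-zero (double w) , balanced-zero (suc (double w)) , balanced-zero (suc (suc (double w)))
  ... | even (suc m′) | even w′
    with b₀ , b₁ , _ ← rec (s≤s (s≤s (x≤double m′))) w′
                           (trans (sym (binom₂-double-double w′ (suc m′))) odd-binom)
    = balanced-double-double (double w′) (suc m′) b₀ ,
      balanced-odd-double (double w′) (suc m′) b₀ ,
      balanced-double-double (suc (double w′)) (suc m′) b₁
  ... | even (suc m′) | odd w′
    with _ , b₁ , b₂ ← rec (s≤s (s≤s (x≤double m′))) w′
                           (trans (sym (binom₂-odd-double w′ (suc m′))) odd-binom)
    = balanced-double-double (suc (double w′)) (suc m′) b₁ ,
      balanced-odd-double (suc (double w′)) (suc m′) b₁ ,
      balanced-double-double (suc (suc (double w′))) (suc m′) b₂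
  ... | odd m′        | even w′
    with b₀ , b₁ , _ ← rec (s≤s (x≤double m′)) w′
                           (trans (sym (binom₂-double-odd w′ m′)) odd-binom)
    = balanced-double-odd (double w′) m′ b₀ ,
      balanced-odd-odd (double w′) m′ (trans (σ-suc-double w′) (cong suc (sym (σ-double w′)))) b₁ ,
      balanced-double-odd (suc (double w′)) m′ b₁
  ... | odd m′        | odd w′ with () ← trans (sym odd-binom) (binom₂-odd-odd w′ m′)

S-vanishes : ∀ {n k} → n < k → S n k ≡ 0
S-vanishes {zero}  {suc k} _          = refl
S-vanishes {suc n} {suc k} (s≤s n<k) =
  cong₂ _+_ (trans (cong (suc k *_) (S-vanishes (m<n⇒m<1+n n<k))) (*-zeroʳ (suc k))) (S-vanishes n<k)

S-diagonal : ∀ n → S n n ≡ 1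
S-diagonal zero    = refl
S-diagonal (suc n) =
  cong₂ _+_ (trans (cong (suc n *_) (S-vanishes (n<1+n n))) (*-zeroʳ (suc n))) (S-diagonal n)

S-one : ∀ n → S (suc n) 1 ≡ 1
S-one zero    = refl
S-one (suc n) = cong (_+ 0) (trans (*-identityˡ (S (suc n) 1)) (S-one n))

S-positive : ∀ {n k} → k ≤ n → 0 < S (suc n) (suc k)
S-positive {n}     {zero}  _         = subst (0 <_) (sym (S-one n)) (s≤s z≤n)
S-positive {suc n} {suc k} (s≤s k≤n) =
  ≤-trans (S-positive k≤n) (m≤n+m (S (suc n) (suc k)) (suc (suc k) * S (suc n) (suc (suc k))))

parity-S-suc : ∀ n k →
  parity (S (suc n) (suc k)) ≡ (parity (suc k) ⊗ parity (S n (suc k))) ⊕ parity (S n k)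
parity-S-suc n k =
  trans (+-homo-+ (suc k * S n (suc k)) (S n k))
        (cong (_⊕ parity (S n k)) (*-homo-* (suc k) (S n (suc k))))

mutual
  parity-S-odd : ∀ w m → parity (S (suc (double w + m)) (suc (double w))) ≡ binom₂ w m
  parity-S-odd zero    m       = cong parity (S-one m)
  parity-S-odd (suc w) zero
    rewrite +-identityʳ (double w) | S-diagonal (suc (suc (suc (double w)))) = refl
  parity-S-odd (suc w) (suc m) = begin
    parity (S (suc (suc (suc (double w + suc m)))) (suc (suc (suc (double w)))))
      ≡⟨ parity-S-suc (suc (suc (double w + suc m))) (suc (suc (double w))) ⟩
    (parity (suc (double w)) ⊗ parity (S (suc (suc (double w + suc m))) (suc (suc (suc (double w))))))
      ⊕ parity (S (suc (suc (double w + suc m))) (suc (suc (double w))))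
      ≡⟨ cong₂ _⊕_ (cong₂ _⊗_ (parity-suc-double w) shifted) (parity-S-even w (suc m)) ⟩
    binom₂ (suc w) m ⊕ binom₂ w (suc m)
      ≡⟨ ⊕-comm (binom₂ (suc w) m) (binom₂ w (suc m)) ⟩
    binom₂ (suc w) (suc m) ∎
    where
    open ≡-Reasoning
    shifted : parity (S (suc (suc (double w + suc m))) (suc (suc (suc (double w))))) ≡ binom₂ (suc w) m
    shifted =
      trans (cong (λ n → parity (S (suc (suc n)) (suc (suc (suc (double w)))))) (+-suc (double w) m))
            (parity-S-odd (suc w) m)

  parity-S-even : ∀ w m → parity (S (suc (suc (double w + m))) (suc (suc (double w)))) ≡ binom₂ w m
  parity-S-even w zero
    rewrite +-identityʳ (double w) | S-diagonal (suc (suc (double w))) = sym (binom₂-zeroʳ w)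
  parity-S-even w (suc m) = begin
    parity (S (suc (suc (double w + suc m))) (suc (suc (double w))))
      ≡⟨ parity-S-suc (suc (double w + suc m)) (suc (double w)) ⟩
    (parity (double w) ⊗ parity (S (suc (double w + suc m)) (suc (suc (double w)))))
      ⊕ parity (S (suc (double w + suc m)) (suc (double w)))
      ≡⟨ cong (λ p → (p ⊗ parity (S (suc (double w + suc m)) (suc (suc (double w)))))
                       ⊕ parity (S (suc (double w + suc m)) (suc (double w)))) (parity-double w) ⟩
    parity (S (suc (double w + suc m)) (suc (double w)))
      ≡⟨ parity-S-odd w (suc m) ⟩
    binom₂ w (suc m) ∎
    where open ≡-Reasoning

parity≡0ℙ⇒2∣ : ∀ n → parity n ≡ 0ℙ → 2 ∣ n
parity≡0ℙ⇒2∣ zero          _  = 2 ∣0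
parity≡0ℙ⇒2∣ (suc (suc n)) p = ∣m∣n⇒∣m+n ∣-refl (parity≡0ℙ⇒2∣ n p)

¬2∣⇒parity≡1ℙ : ∀ n → ¬ 2 ∣ n → parity n ≡ 1ℙ
¬2∣⇒parity≡1ℙ n ¬2∣n with parity n in p
... | 1ℙ = refl
... | 0ℙ = ⊥-elim (¬2∣n (parity≡0ℙ⇒2∣ n p))

¬2∣⇒%2≡1 : ∀ n → ¬ 2 ∣ n → n % 2 ≡ 1
¬2∣⇒%2≡1 n ¬2∣n with n % 2 in n%2 | m%n<n n 2
... | 0           | _               = ⊥-elim (¬2∣n (m%n≡0⇒n∣m n 2 n%2))
... | 1           | _               = refl
... | suc (suc _) | s≤s (s≤s ())

¬2∣⇒ν≡0 : ∀ n → ¬ 2 ∣ n → ν n ≡ 0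
¬2∣⇒ν≡0 zero    _    = refl
¬2∣⇒ν≡0 (suc n) ¬2∣n rewrite ¬2∣⇒%2≡1 (suc n) ¬2∣n = refl

2∣⇒0<ν : ∀ n → 0 < n → 2 ∣ n → 0 < ν n
2∣⇒0<ν (suc n) _ 2∣n rewrite n∣m⇒m%n≡0 (suc n) 2 2∣n = s≤s z≤n

ν≡0⇒¬2∣ : ∀ n → 0 < n → ν n ≡ 0 → ¬ 2 ∣ n
ν≡0⇒¬2∣ n 0<n ν≡0 2∣n = n≮0 (subst (0 <_) ν≡0 (2∣⇒0<ν n 0<n 2∣n))

odd-S⇒balanced : ∀ j m → ¬ 2 ∣ S (suc (j + m)) (suc j) → Balanced j m × Balanced (suc j) m
odd-S⇒balanced j m ¬2∣S with halves j | ¬2∣⇒parity≡1ℙ _ ¬2∣S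
... | even w | odd-S
  with b₀ , b₁ , _ ← binom₂-odd⇒balanced m w (trans (sym (parity-S-odd w m)) odd-S) = b₀ , b₁
... | odd w  | odd-S
  with _ , b₁ , b₂ ← binom₂-odd⇒balanced m w (trans (sym (parity-S-even w m)) odd-S) = b₁ , b₂

¬2∣⇔ν-formula : ∀ {x a b c} → 0 < x → (¬ 2 ∣ x → c + b ≡ a) →
  (¬ 2 ∣ x) ⇔ ((+ c ≡ (+ a) - (+ b)) × (+ ν x ≡ ((+ b) - (+ a)) +ℤ (+ c)))
¬2∣⇔ν-formula {x} {a} {b} {c} 0<x balanced = mk⇔ to from
  where
  to : ¬ 2 ∣ x → (+ c ≡ (+ a) - (+ b)) × (+ ν x ≡ ((+ b) - (+ a)) +ℤ (+ c))
  to ¬2∣x rewrite ¬2∣⇒ν≡0 x ¬2∣x | sym (balanced ¬2∣x) =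
    cancel (+ c) (+ b) , cancel′ (+ c) (+ b)
    where
    cancel : ∀ (u v : ℤ) → u ≡ (u +ℤ v) - v
    cancel = solve-∀
    cancel′ : ∀ (u v : ℤ) → + 0 ≡ (v - (u +ℤ v)) +ℤ u
    cancel′ = solve-∀
  from : (+ c ≡ (+ a) - (+ b)) × (+ ν x ≡ ((+ b) - (+ a)) +ℤ (+ c)) → ¬ 2 ∣ x
  from (c≡a-b , ν≡b-a+c) = ν≡0⇒¬2∣ x 0<x (+-injective (begin
    + ν x                              ≡⟨ ν≡b-a+c ⟩
    ((+ b) - (+ a)) +ℤ (+ c)           ≡⟨ cong (((+ b) - (+ a)) +ℤ_) c≡a-b ⟩
    ((+ b) - (+ a)) +ℤ ((+ a) - (+ b)) ≡⟨ opposites (+ a) (+ b) ⟩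
    + 0                                ∎))
    where
    open ≡-Reasoning
    opposites : ∀ (u v : ℤ) → (v - u) +ℤ (u - v) ≡ + 0
    opposites = solve-∀

theorem3p2 : (n k : ℕ) → 1 ≤ k → k ≤ n →
  ((¬ (2 ∣ S n k))
    ⇔ ((+ #∩ n (n ∸ k) ≡ (+ σ n) - (+ σ k) × (+ ν (S n k)) ≡ ((+ σ k) - (+ σ n)) +ℤ (+ #∩ n (n ∸ k)))))
  × ((¬ (2 ∣ S n k))
    ⇔ ((+ #∩ (n ∸ 1) (n ∸ k) ≡ (+ σ (n ∸ 1)) - (+ σ (k ∸ 1)))
       × (+ ν (S n k)) ≡ ((+ σ (k ∸ 1)) - (+ σ (n ∸ 1))) +ℤ (+ #∩ (n ∸ 1) (n ∸ k))))
theorem3p2 (suc n) (suc j) _ (s≤s j≤n)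
  with m , refl ← m≤n⇒∃[o]m+o≡n j≤n
  rewrite m+n∸m≡n j m =
    ¬2∣⇔ν-formula (S-positive j≤n) (proj₂ ∘ odd-S⇒balanced j m)
  , ¬2∣⇔ν-formula (S-positive j≤n) (proj₁ ∘ odd-S⇒balanced j m)
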